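{- Let $n\ge1$. The set of monomials $\{m(\mathcal{R}_1)m(\mathcal{R}_2)^2 : \mathcal{R}_1,\mathcal{R}_2\subseteq[n]\times[n],\ \mathcal{R}_1\cup\mathcal{R}_2 \text{ is a rook placement}\}$ descends to a spanning set of $\mathbb{C}[\mathbf{x}_{n\times n}]/I_{B_n}$.
   Context: $\mathbb{C}[\mathbf{x}_{n\times n}]$ is the polynomial ring in variables $x_{i,j}$, $1\le i,j\le n$. $I_{B_n}$ is the ideal generated by: $x_{i,j}^3$ for all $i,j$; $x_{i,j}x_{i,j'}$ for all $i$ and $j<j'$; $x_{i,j}x_{i',j}$ for all $j$ and $i<i'$; $\sum_{j=1}^n x_{i,j}^2$ for each $i$; $\sum_{i=1}^n x_{i,j}^2$ for each $j$. For $S\subseteq[n]\times[n]$, $m(S)=\prod_{(i,j)\in S}x_{i,j}$. A rook placement is a subset of $[n]\times[n]$ containing at most one point in each row and each column (no two points share a first coordinate or a second coordinate). -}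

module Defs where

open import Level using (Level; _⊔_)
open import Algebra.Bundles using (CommutativeRing)
open import Data.Nat as ℕ using (ℕ)
open import Data.Fin as Fin using (Fin)
open import Data.Bool using (Bool; true; false; if_then_else_; _∨_; _∧_; T)
open import Data.Vec as Vec using (Vec; tabulate; zipWith)
open import Data.Vec.Properties using (≡-dec)
open import Data.List as List using (List; []; _∷_; _++_; map; foldr; concatMap; allFin)
open import Data.Product using (Σ; ∃; _×_; _,_)
open import Relation.Nullary using (Dec; does)
open import Relation.Binary.PropositionalEquality using (_≡_)

Mon : ℕ → Set
Mon n = Vec (Vec ℕ n) n

_≟M_ : ∀ {n} (a b : Mon n) → Dec (a ≡ b)
_≟M_ = ≡-dec (≡-dec ℕ._≟_)

mulMon : ∀ {n} → Mon n → Mon n → Mon n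
mulMon = zipWith (zipWith ℕ._+_)

single : ∀ {n} → Fin n → Fin n → ℕ → Mon n
single i j k = tabulate λ a → tabulate λ b →
  if does (a Fin.≟ i) ∧ does (b Fin.≟ j) then k else 0

Cells : ℕ → Set
Cells n = Fin n → Fin n → Bool

_∪_ : ∀ {n} → Cells n → Cells n → Cells n
(A ∪ B) i j = A i j ∨ B i j

IsRookPlacement : ∀ {n} → Cells n → Set
IsRookPlacement {n} S =
  (∀ (i j j' : Fin n) → T (S i j) → T (S i j') → j ≡ j') ×
  (∀ (i i' j : Fin n) → T (S i j) → T (S i' j) → i ≡ i')

cellsMon : ∀ {n} → Cells n → ℕ → Mon n
cellsMon S k = tabulate λ i → tabulate λ j → if S i j then k else 0

-- Polynomials over a commutative ring R in the variables x_{i,j},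
-- represented as formal finite sums of terms (coefficient, monomial),
-- compared by coefficients.
module _ {c ℓ} (R : CommutativeRing c ℓ) where
  open CommutativeRing R renaming (Carrier to K)

  Poly : ℕ → Set c
  Poly n = List (K × Mon n)

  coeff : ∀ {n} → Poly n → Mon n → K
  coeff p m = foldr (λ { (a , m') acc → if does (m' ≟M m) then a + acc else acc }) 0# p

  _≃P_ : ∀ {n} → Poly n → Poly n → Set ℓ
  p ≃P q = ∀ m → coeff p m ≈ coeff q m

  0P : ∀ {n} → Poly n
  0P = []

  _+P_ : ∀ {n} → Poly n → Poly n → Poly n
  p +P q = p ++ q

  -P_ : ∀ {n} → Poly n → Poly n
  -P p = map (λ { (a , m) → (- a , m) }) p

  _-P_ : ∀ {n} → Poly n → Poly n → Poly n
  p -P q = p +P (-P q)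

  _*P_ : ∀ {n} → Poly n → Poly n → Poly n
  p *P q = concatMap (λ { (a , m) → map (λ { (b , m') → (a * b , mulMon m m') }) q }) p

  _·P_ : ∀ {n} → K → Poly n → Poly n
  k ·P p = map (λ { (a , m) → (k * a , m) }) p

  monoP : ∀ {n} → Mon n → Poly n
  monoP m = (1# , m) ∷ []

  rookMonomial : ∀ {n} → Cells n → Cells n → Poly n
  rookMonomial A B = monoP (mulMon (cellsMon A 1) (cellsMon B 2))

  data Gen (n : ℕ) : Set where
    cube    : (i j : Fin n) → Gen n
    rowPair : (i j j' : Fin n) → j Fin.< j' → Gen n
    colPair : (i i' j : Fin n) → i Fin.< i' → Gen n
    rowSum  : (i : Fin n) → Gen n
    colSum  : (j : Fin n) → Gen n

  gen : ∀ {n} → Gen n → Poly n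
  gen (cube i j)          = monoP (single i j 3)
  gen (rowPair i j j' _)  = monoP (mulMon (single i j 1) (single i j' 1))
  gen (colPair i i' j _)  = monoP (mulMon (single i j 1) (single i' j 1))
  gen {n} (rowSum i)      = map (λ j → (1# , single i j 2)) (allFin n)
  gen {n} (colSum j)      = map (λ i → (1# , single i j 2)) (allFin n)

  InIdeal : ∀ {n} → Poly n → Set (c ⊔ ℓ)
  InIdeal {n} p = ∃ λ (cs : List (Poly n × Gen n)) →
    p ≃P foldr (λ { (q , g) acc → (q *P gen g) +P acc }) 0P cs

  RookPair : ℕ → Set
  RookPair n = Σ (Cells n × Cells n) λ { (A , B) → IsRookPlacement (A ∪ B) }

  combination : ∀ {n} → List (K × RookPair n) → Poly n
  combination = foldr (λ { (k , ((A , B) , _)) acc → (k ·P rookMonomial A B) +P acc }) 0P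

{-# OPTIONS --safe #-}
module Submission where

-- A monomial with an
-- exponent ≥ 3, or with two variables in a common row or column, is a
-- multiple of x_{i,j}^3, x_{i,j} x_{i,j'} or x_{i,j} x_{i',j}, hence lies in
-- I_{B_n}.  Every other monomial has exponents in {0, 1, 2} supported on a
-- rook placement, so it is m(R₁) m(R₂)^2 where R_k is the set of cells of
-- exponent k.  Reducing a polynomial term by term therefore writes it as a
-- combination of such monomials modulo I_{B_n}.

open import Defs
open import Algebra.Bundles using (CommutativeRing)
open import Data.Nat using (ℕ; _≤_)
open import Data.List using (List)
open import Data.Product using (∃; _×_)

import Algebra.Properties.CommutativeSemigroup as CommutativeSemigroupProperties
open import Data.Bool using (true; false; if_then_else_; _∨_; _∧_; T)
open import Data.Empty using (⊥; ⊥-elim)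
open import Data.Fin as Fin using (Fin)
import Data.Fin.Properties as Fin
open import Data.List using ([]; _∷_; _++_)
import Data.Nat as ℕ
open import Data.Nat using (suc; z≤n; s≤s; _<_; _∸_; _≡ᵇ_; _≤?_)
open import Data.Nat.Properties using (≰⇒>; m∸n+n≡m)
open import Data.Product using (Σ; _,_; proj₁; proj₂)
import Data.Product.Properties as Product
open import Data.Sum using (_⊎_; inj₁; inj₂)
open import Data.Vec using (lookup; tabulate)
open import Data.Vec.Properties using (lookup∘tabulate; tabulate∘lookup; tabulate-cong; lookup-zipWith)
open import Relation.Binary.Definitions using (tri<; tri≈; tri>)
open import Relation.Binary.PropositionalEquality using (_≡_; _≢_; refl; cong; cong₂; subst)
import Relation.Binary.PropositionalEquality as ≡
open import Relation.Nullary using (Dec; yes; no; does; ¬_)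
open import Relation.Nullary.Decidable using (_×-dec_; dec-true)

exponent : ∀ {n} → Mon n → Fin n → Fin n → ℕ
exponent m i j = lookup (lookup m i) j

Mon-ext : ∀ {n} {m m' : Mon n} → (∀ i j → exponent m i j ≡ exponent m' i j) → m ≡ m'
Mon-ext {m = m} {m'} eq = ≡.trans (≡.sym (tabulate∘lookup m))
  (≡.trans (tabulate-cong λ i → Vec-ext (eq i)) (tabulate∘lookup m'))
  where
  Vec-ext : ∀ {i} → (∀ j → lookup (lookup m i) j ≡ lookup (lookup m' i) j) → lookup m i ≡ lookup m' i
  Vec-ext {i} eqᵢ = ≡.trans (≡.sym (tabulate∘lookup (lookup m i)))
    (≡.trans (tabulate-cong eqᵢ) (tabulate∘lookup (lookup m' i)))

exponent-tabulate : ∀ {n} (f : Fin n → Fin n → ℕ) i j →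
  exponent (tabulate λ a → tabulate λ b → f a b) i j ≡ f i j
exponent-tabulate f i j =
  ≡.trans (cong (λ row → lookup row j) (lookup∘tabulate _ i)) (lookup∘tabulate _ j)

exponent-mulMon : ∀ {n} (a b : Mon n) i j → exponent (mulMon a b) i j ≡ exponent a i j ℕ.+ exponent b i j
exponent-mulMon a b i j = ≡.trans (cong (λ row → lookup row j) (lookup-zipWith _ i a b))
  (lookup-zipWith _ j (lookup a i) (lookup b i))

exponent-single : ∀ {n} (i j : Fin n) k a b →
  exponent (single i j k) a b ≡ (if does (a Fin.≟ i) ∧ does (b Fin.≟ j) then k else 0)
exponent-single i j k = exponent-tabulate _

exponent-single-≢ : ∀ {n} {i j a b : Fin n} k → (a , b) ≢ (i , j) → exponent (single i j k) a b ≡ 0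
exponent-single-≢ {i = i} {j} {a} {b} k ab≢ij rewrite exponent-single i j k a b
  with a Fin.≟ i | b Fin.≟ j
... | yes refl | yes refl = ⊥-elim (ab≢ij refl)
... | yes _    | no _     = refl
... | no _     | _        = refl

exponent-single-≡ : ∀ {n} (i j : Fin n) k → exponent (single i j k) i j ≡ k
exponent-single-≡ i j k rewrite exponent-single i j k i j
  | dec-true (i Fin.≟ i) refl | dec-true (j Fin.≟ j) refl = refl

infix 4 _∣M_

_∣M_ : ∀ {n} → Mon n → Mon n → Set
d ∣M m = ∀ i j → exponent d i j ≤ exponent m i j

_/M_ : ∀ {n} → Mon n → Mon n → Mon n
m /M d = tabulate λ i → tabulate λ j → exponent m i j ∸ exponent d i j

/M-mulMon : ∀ {n} {d m : Mon n} → d ∣M m → mulMon (m /M d) d ≡ m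
/M-mulMon {d = d} {m} d∣m = Mon-ext λ i j → begin
  exponent (mulMon (m /M d) d) i j                   ≡⟨ exponent-mulMon (m /M d) d i j ⟩
  exponent (m /M d) i j ℕ.+ exponent d i j           ≡⟨ cong (ℕ._+ exponent d i j) (exponent-tabulate _ i j) ⟩
  exponent m i j ∸ exponent d i j ℕ.+ exponent d i j ≡⟨ m∸n+n≡m (d∣m i j) ⟩
  exponent m i j                                     ∎
  where open ≡.≡-Reasoning

_≟²_ : ∀ {n} → (p q : Fin n × Fin n) → Dec (p ≡ q)
_≟²_ = Product.≡-dec Fin._≟_ Fin._≟_

single-∣M : ∀ {n} (m : Mon n) {i j k} → k ≤ exponent m i j → single i j k ∣M m
single-∣M m {i} {j} {k} k≤m a b with (a , b) ≟² (i , j)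
... | yes refl rewrite exponent-single-≡ i j k = k≤m
... | no ab≢ij rewrite exponent-single-≢ k ab≢ij = z≤n

Positive : ∀ {n} → Mon n → Fin n → Fin n → Set
Positive m i j = 1 ≤ exponent m i j

pair-∣M : ∀ {n} (m : Mon n) {i j i' j'} → (i , j) ≢ (i' , j') →
  Positive m i j → Positive m i' j' → mulMon (single i j 1) (single i' j' 1) ∣M m
pair-∣M m {i} {j} {i'} {j'} ij≢i'j' pos pos' a b
  rewrite exponent-mulMon (single i j 1) (single i' j' 1) a b
  with (a , b) ≟² (i , j) | (a , b) ≟² (i' , j')
... | yes refl | _ rewrite exponent-single-≡ i j 1 | exponent-single-≢ 1 ij≢i'j' = pos
... | no ab≢ij | yes refl rewrite exponent-single-≢ 1 ab≢ij | exponent-single-≡ i' j' 1 = pos'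
... | no ab≢ij | no ab≢i'j' rewrite exponent-single-≢ 1 ab≢ij | exponent-single-≢ 1 ab≢i'j' = z≤n

cellsWithExponent : ∀ {n} → Mon n → ℕ → Cells n
cellsWithExponent m k i j = exponent m i j ≡ᵇ k

ones+twos≡ : ∀ k → k < 3 → (if k ≡ᵇ 1 then 1 else 0) ℕ.+ (if k ≡ᵇ 2 then 2 else 0) ≡ k
ones+twos≡ 0 _ = refl
ones+twos≡ 1 _ = refl
ones+twos≡ 2 _ = refl
ones+twos≡ (suc (suc (suc _))) (s≤s (s≤s (s≤s ())))

exponent-cellsMon : ∀ {n} (S : Cells n) k i j → exponent (cellsMon S k) i j ≡ (if S i j then k else 0)
exponent-cellsMon S k = exponent-tabulate _

cellsWithExponent-mulMon : ∀ {n} {m : Mon n} → (∀ i j → exponent m i j < 3) →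
  mulMon (cellsMon (cellsWithExponent m 1) 1) (cellsMon (cellsWithExponent m 2) 2) ≡ m
cellsWithExponent-mulMon {m = m} small = Mon-ext λ i j → begin
  exponent (mulMon (cellsMon A 1) (cellsMon B 2)) i j         ≡⟨ exponent-mulMon (cellsMon A 1) (cellsMon B 2) i j ⟩
  exponent (cellsMon A 1) i j ℕ.+ exponent (cellsMon B 2) i j ≡⟨ cong₂ ℕ._+_ (exponent-cellsMon A 1 i j) (exponent-cellsMon B 2 i j) ⟩
  (if A i j then 1 else 0) ℕ.+ (if B i j then 2 else 0)       ≡⟨ ones+twos≡ (exponent m i j) (small i j) ⟩
  exponent m i j                                              ∎
  where
  open ≡.≡-Reasoning
  A B : Cells _
  A = cellsWithExponent m 1
  B = cellsWithExponent m 2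

one-or-two⇒positive : ∀ k → T ((k ≡ᵇ 1) ∨ (k ≡ᵇ 2)) → 1 ≤ k
one-or-two⇒positive (suc _) _ = s≤s z≤n

RowClash : ∀ {n} → Mon n → Set
RowClash m = ∃ λ i → ∃ λ j → ∃ λ j' → j Fin.< j' × Positive m i j × Positive m i j'

ColClash : ∀ {n} → Mon n → Set
ColClash m = ∃ λ i → ∃ λ i' → ∃ λ j → i Fin.< i' × Positive m i j × Positive m i' j

rowClash? : ∀ {n} (m : Mon n) → Dec (RowClash m)
rowClash? m = Fin.any? λ i → Fin.any? λ j → Fin.any? λ j' →
  j Fin.<? j' ×-dec 1 ≤? exponent m i j ×-dec 1 ≤? exponent m i j'

colClash? : ∀ {n} (m : Mon n) → Dec (ColClash m)
colClash? m = Fin.any? λ i → Fin.any? λ i' → Fin.any? λ j →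
  i Fin.<? i' ×-dec 1 ≤? exponent m i j ×-dec 1 ≤? exponent m i' j

≡-if-no-ordered-pair : ∀ {n p} {P : Fin n → Set p} →
  (∀ {a b} → a Fin.< b → P a → P b → ⊥) → ∀ {a b} → P a → P b → a ≡ b
≡-if-no-ordered-pair never {a} {b} pa pb with Fin.<-cmp a b
... | tri< a<b _ _ = ⊥-elim (never a<b pa pb)
... | tri≈ _ a≡b _ = a≡b
... | tri> _ _ b<a = ⊥-elim (never b<a pb pa)

clashFree⇒isRookPlacement : ∀ {n} (m : Mon n) (S : Cells n) → (∀ {i j} → T (S i j) → Positive m i j) →
  ¬ RowClash m → ¬ ColClash m → IsRookPlacement S
clashFree⇒isRookPlacement m S S⇒positive noRowClash noColClash = sameRow , sameCol
  where
  sameRow : ∀ i j j' → T (S i j) → T (S i j') → j ≡ j'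
  sameRow i j j' s s' = ≡-if-no-ordered-pair {P = Positive m i}
    (λ j<j' p p' → noRowClash (i , _ , _ , j<j' , p , p')) (S⇒positive s) (S⇒positive s')
  sameCol : ∀ i i' j → T (S i j) → T (S i' j) → i ≡ i'
  sameCol i i' j s s' = ≡-if-no-ordered-pair {P = λ i → Positive m i j}
    (λ i<i' p p' → noColClash (_ , _ , j , i<i' , p , p')) (S⇒positive s) (S⇒positive s')

module _ {c ℓ} (R : CommutativeRing c ℓ) where
  open CommutativeRing R
    using (_≈_; _+_; _*_; -_; 0#; 1#; setoid; +-cong; +-congˡ; +-congʳ; +-assoc; +-identityˡ;
           -‿cong; -‿inverseʳ; *-identityʳ; +-commutativeSemigroup)
    renaming (Carrier to K; refl to ≈-refl; sym to ≈-sym; trans to ≈-trans)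
  open CommutativeSemigroupProperties +-commutativeSemigroup using (x∙yz≈y∙xz)

  private
    infix 4 _≃_
    _≃_ : ∀ {n} → Poly R n → Poly R n → Set ℓ
    _≃_ = _≃P_ R

  IsRookMonomial : ∀ {n} → Mon n → Set
  IsRookMonomial {n} m = Σ (RookPair R n) λ { ((A , B) , _) → mulMon (cellsMon A 1) (cellsMon B 2) ≡ m }

  MultipleOfGenerator : ∀ {n} → Mon n → Set c
  MultipleOfGenerator {n} m = ∃ λ (g : Gen R n) → ∃ λ G → gen R g ≡ monoP R G × G ∣M m

  rook⊎multipleOfGenerator : ∀ {n} (m : Mon n) → IsRookMonomial m ⊎ MultipleOfGenerator m
  rook⊎multipleOfGenerator m with Fin.any? (λ i → Fin.any? λ j → 3 ≤? exponent m i j)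
  ... | yes (i , j , 3≤m) = inj₂ (cube i j , _ , refl , single-∣M m 3≤m)
  ... | no noCube with rowClash? m
  ... | yes (i , j , j' , j<j' , p , p') =
    inj₂ (rowPair i j j' j<j' , _ , refl , pair-∣M m (λ eq → Fin.<-irrefl (cong proj₂ eq) j<j') p p')
  ... | no noRowClash with colClash? m
  ... | yes (i , i' , j , i<i' , p , p') =
    inj₂ (colPair i i' j i<i' , _ , refl , pair-∣M m (λ eq → Fin.<-irrefl (cong proj₁ eq) i<i') p p')
  ... | no noColClash = inj₁ (((A , B) , placement) , cellsWithExponent-mulMon small)
    where
    A B : Cells _
    A = cellsWithExponent m 1
    B = cellsWithExponent m 2
    placement : IsRookPlacement (A ∪ B)
    placement = clashFree⇒isRookPlacement m (A ∪ B) (λ {i} {j} → one-or-two⇒positive (exponent m i j))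
      noRowClash noColClash
    small : ∀ i j → exponent m i j < 3
    small i j = ≰⇒> λ 3≤m → noCube (i , j , 3≤m)

  ∷-cong : ∀ {n} {a b : K} (m : Mon n) {r r' : Poly R n} → a ≈ b → r ≃ r' →
    ((a , m) ∷ r) ≃ ((b , m) ∷ r')
  ∷-cong m a≈b r≃r' x with does (m ≟M x)
  ... | true  = +-cong a≈b (r≃r' x)
  ... | false = r≃r' x

  ∷-swap : ∀ {n} (s t : K × Mon n) r → (s ∷ t ∷ r) ≃ (t ∷ s ∷ r)
  ∷-swap (a , m) (b , m') r x with does (m ≟M x) | does (m' ≟M x)
  ... | true  | true  = x∙yz≈y∙xz a b _
  ... | true  | false = ≈-refl
  ... | false | _     = ≈-refl

  ++-∷ : ∀ {n} (p : Poly R n) t q → (p ++ t ∷ q) ≃ (t ∷ p ++ q)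
  ++-∷ []            t q x = ≈-refl
  ++-∷ ((a , m) ∷ p) t q x =
    ≈-trans (∷-cong m {p ++ t ∷ q} {t ∷ p ++ q} ≈-refl (++-∷ p t q) x) (∷-swap (a , m) t (p ++ q) x)

  ∷-cancel : ∀ {n} a (m : Mon n) r → ((a , m) ∷ (- (a * 1#) , m) ∷ r) ≃ r
  ∷-cancel a m r x with does (m ≟M x)
  ... | false = ≈-refl
  ... | true  = begin
    a + (- (a * 1#) + coeff R r x) ≈⟨ +-congˡ (+-congʳ (-‿cong (*-identityʳ a))) ⟩
    a + (- a + coeff R r x)        ≈⟨ ≈-sym (+-assoc a (- a) _) ⟩
    a + - a + coeff R r x          ≈⟨ +-congʳ (-‿inverseʳ a) ⟩
    0# + coeff R r x               ≈⟨ +-identityˡ _ ⟩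
    coeff R r x                    ∎
    where open import Relation.Binary.Reasoning.Setoid setoid

  ∷-++-cancel : ∀ {n} a (m : Mon n) p q → ((a , m) ∷ p ++ (- (a * 1#) , m) ∷ q) ≃ (p ++ q)
  ∷-++-cancel a m p q x =
    ≈-trans (∷-cong m {p ++ t ∷ q} {t ∷ p ++ q} ≈-refl (++-∷ p t q) x) (∷-cancel a m (p ++ q) x)
    where
    t : K × Mon _
    t = - (a * 1#) , m

  -- This is the shape of ((a , m) ∷ p) -P combination ((a , rp) ∷ cs) when rp gives the monomial m.
  InIdeal-∷-cancel : ∀ {n} a (m : Mon n) p q → InIdeal R (p ++ q) →
    InIdeal R ((a , m) ∷ p ++ (- (a * 1#) , m) ∷ q)
  InIdeal-∷-cancel a m p q (ds , p++q≃I) = ds , λ x → ≈-trans (∷-++-cancel a m p q x) (p++q≃I x)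

  InIdeal-∷-multiple : ∀ {n} a (m : Mon n) q → MultipleOfGenerator m → InIdeal R q →
    InIdeal R ((a , m) ∷ q)
  InIdeal-∷-multiple a m q (g , G , gen≡ , G∣m) (ds , q≃I) =
    subst (λ m → InIdeal R ((a , m) ∷ q)) (/M-mulMon {d = G} {m} G∣m)
      (((a , m /M G) ∷ [] , g) ∷ ds , multiple≃ (m /M G) q≃I)
    where
    multiple≃ : ∀ Q {I} → q ≃ I → ((a , mulMon Q G) ∷ q) ≃ (_*P_ R ((a , Q) ∷ []) (gen R g) ++ I)
    multiple≃ Q {I} q≃I rewrite gen≡ = ∷-cong (mulMon Q G) {q} {I} (≈-sym (*-identityʳ a)) q≃I

  rookMonomials-span : ∀ {n} (p : Poly R n) →
    ∃ λ (cs : List (K × RookPair R n)) → InIdeal R (_-P_ R p (combination R cs))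
  rookMonomials-span [] = [] , [] , λ _ → ≈-refl
  rookMonomials-span ((a , m) ∷ p) with rookMonomials-span p | rook⊎multipleOfGenerator m
  ... | cs , p-cs∈I | inj₁ (rp@((A , B) , _) , refl) =
    (a , rp) ∷ cs ,
    InIdeal-∷-cancel a (mulMon (cellsMon A 1) (cellsMon B 2)) p (-P_ R (combination R cs)) p-cs∈I
  ... | cs , p-cs∈I | inj₂ multiple =
    cs , InIdeal-∷-multiple a m (_-P_ R p (combination R cs)) multiple p-cs∈I

lemma3p10 : ∀ {c ℓ} (R : CommutativeRing c ℓ) (n : ℕ) → 1 ≤ n →
    ∀ (p : Poly R n) →
      ∃ λ (cs : List (CommutativeRing.Carrier R × RookPair R n)) →
        InIdeal R (_-P_ R p (combination R cs))
lemma3p10 R n _ = rookMonomials-span R
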